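{- Let $r\in\{0,1\}$. If a vector $(x_\alpha,\ldots,x_1)$ is $r$-realizable, then so is every vector $(y_\alpha,\ldots,y_1)$ with $x_i\le y_i$ for all $1\le i\le\alpha$.
   Context: All graphs are finite, nonempty, simple and reflexive. Corner ranking: $N[v]$ is the closed neighborhood. In a graph $H$, $w$ strictly corners a distinct vertex $v$ if $N[v]\subsetneq N[w]$. Set $G^{(1)}=G$, $k=1$. If $G^{(k)}$ is a clique, give its vertices rank $k$ and stop; else if it has no strict corners, give its vertices rank $\infty$ and stop; else give all strict corners of $G^{(k)}$ rank $k$, delete them to get $G^{(k+1)}$, increase $k$, repeat. The corner rank $\alpha$ is the largest vertex rank; cop-win graphs are those with finite corner rank. $G$ is of type 1 if some (equivalently every) vertex of rank $\alpha$ is adjacent to all vertices of $G^{(\alpha-1)}$, type 0 otherwise. The rank cardinality vector of $G$ is $(x_\alpha,\ldots,x_1)$, $x_k$ the number of vertices of rank $k$. A vector of positive integers is $r$-realizable if it is the rank cardinality vector of some cop-win graph of type $r$. -}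

module Defs where

open import Data.Nat using (ℕ; zero; suc; _≤_; _<_; _∸_; _≡ᵇ_)
open import Data.Fin using (Fin; toℕ)
open import Data.Bool using (Bool; true; false; _∧_; _∨_; not; T; if_then_else_)
open import Data.List using (List; allFin; map)
open import Data.Bool.ListAction using (all; any)
open import Data.Nat.ListAction using (sum)
open import Data.Product using (Σ; _×_)
open import Relation.Binary.PropositionalEquality using (_≡_)
open import Relation.Nullary using (¬_)

-- A finite, simple, reflexive graph on the vertex set Fin n.
-- Simplicity is automatic for a Bool-valued adjacency relation.
record Graph (n : ℕ) : Set where
  field
    adj      : Fin n → Fin n → Bool
    adj-refl : ∀ v → adj v v ≡ true
    adj-sym  : ∀ u v → adj u v ≡ adj v u
open Graph public

-- vertex subsets (the vertex sets of induced subgraphs)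
VSet : ℕ → Set
VSet n = Fin n → Bool

module _ {n : ℕ} (G : Graph n) where

  vertices : List (Fin n)
  vertices = allFin n

  -- In the induced subgraph H = G[S]: N_H[v] ⊊ N_H[w]
  -- (the closed neighbourhood of v is strictly contained in that of w)
  strictlyCorners : VSet n → Fin n → Fin n → Bool
  strictlyCorners S w v =
    S w ∧ S v
      ∧ all (λ u → not (S u ∧ adj G v u) ∨ adj G w u) vertices
      ∧ any (λ u → S u ∧ adj G w u ∧ not (adj G v u)) vertices

  isStrictCorner : VSet n → Fin n → Bool
  isStrictCorner S v = S v ∧ any (λ w → strictlyCorners S w v) vertices

  deleteCorners : VSet n → VSet n
  deleteCorners S v = S v ∧ not (isStrictCorner S v)

  isClique : VSet n → Bool
  isClique S = all (λ u → all (λ v → not (S u ∧ S v) ∨ adj G u v) vertices) vertices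

  -- stage k ↦ vertex set of G^(k); G^(1) = G, G^(k+1) = G^(k) minus its strict corners.
  -- Convention: G^(0) = G (only used in the type definition when α = 1).
  stage : ℕ → VSet n
  stage zero = λ _ → true
  stage (suc zero) = λ _ → true
  stage (suc (suc k)) = deleteCorners (stage (suc k))

  HasCornerRank : ℕ → Set
  HasCornerRank α =
    1 ≤ α × T (isClique (stage α)) × (∀ k → 1 ≤ k → k < α → ¬ T (isClique (stage k)))

  hasRank : ℕ → ℕ → Fin n → Bool
  hasRank α k v = stage k v ∧ ((k ≡ᵇ α) ∨ not (stage (suc k) v))

  rankCount : ℕ → ℕ → ℕ
  rankCount α k = sum (map (λ v → if hasRank α k v then 1 else 0) vertices)

  Type1 : ℕ → Set
  Type1 α = Σ (Fin n) λ v → T (hasRank α α v) × (∀ u → T (stage (α ∸ 1) u) → T (adj G v u))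

  HasType : ℕ → Fin 2 → Set
  HasType α Fin.zero = ¬ Type1 α
  HasType α (Fin.suc Fin.zero) = Type1 α

-- A vector (x_α, …, x_1) is represented as x : Fin α → ℕ with x i = x_{i+1}.
Realizable : Fin 2 → (α : ℕ) → (Fin α → ℕ) → Set
Realizable r α x =
  (∀ i → 1 ≤ x i) ×
  Σ ℕ λ n → 1 ≤ n × Σ (Graph n) λ G →
    HasCornerRank G α × HasType G α r × (∀ (i : Fin α) → rankCount G α (suc (toℕ i)) ≡ x i)

module Submission where

-- Idea: adding a true twin v' of a vertex v (a new vertex with N[v'] = N[v] ∪ {v'})
-- changes nothing in the corner-ranking process except that v' receives the rank of v.
-- So a realizing graph for x yields one for x + e_i (twin a vertex of rank i), and the
-- theorem follows by repeating this until every coordinate reaches its target.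
--
-- The twin graph is treated as the pullback G* of G along a map f : Fin m → Fin n with
-- a section.  Every notion in Defs is a Boolean formula quantifying over all vertices,
-- and such quantifiers are invariant under pullback along a split surjection; hence
-- the stages, the clique tests, the ranks and the type of G* are those of G read
-- through f.

open import Defs
open import Data.Nat using (ℕ; _≤_)
open import Data.Fin using (Fin)

open import Data.Nat using (zero; suc; _+_; _∸_; _<_; _≡ᵇ_; z≤n; s≤s; _≤′_; ≤′-refl; ≤′-step)
open import Data.Nat.Properties using (≤-trans; <-irrefl; <-cmp; ≤⇒≤′; ≡ᵇ⇒≡; m∸n+n≡m; suc-injective)
open import Data.Nat.ListAction using (sum)
open import Data.Fin using (toℕ)
open import Data.Fin.Properties using (toℕ-injective; toℕ<n; _≟_)
open import Data.Bool using (Bool; true; false; _∧_; _∨_; not; T; if_then_else_)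
open import Data.Bool.Properties using (T-∧; T-∨)
open import Data.Bool.ListAction using (all; any; and; or)
open import Data.List using (List; []; _∷_; map; allFin)
open import Data.List.Properties using (map-cong; map-tabulate)
import Data.List.Relation.Unary.All as All
open import Data.List.Relation.Unary.All.Properties using (all⁺; all⁻)
open import Data.List.Relation.Unary.Any using (satisfied)
open import Data.List.Relation.Unary.Any.Properties using (any⁺; any⁻)
open import Data.List.Membership.Propositional using (lose)
open import Data.List.Membership.Propositional.Properties using (∈-allFin)
open import Data.Vec.Functional using (Vector; updateAt) renaming (_∷_ to _◂_)
open import Data.Vec.Functional.Properties using (updateAt-updates; updateAt-minimal)
open import Data.Product using (∃; _,_; proj₁; proj₂)
open import Data.Sum using (inj₁; inj₂)
open import Data.Empty using (⊥; ⊥-elim)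
open import Function using (_∘_; _⇔_; mk⇔; Equivalence)
open import Relation.Nullary using (¬_; yes; no)
open import Relation.Binary.Definitions using (tri<; tri≈; tri>)
open import Relation.Binary.PropositionalEquality
open Equivalence using (to; from)
open ≡-Reasoning

T-ext : ∀ {a b : Bool} → (T a → T b) → (T b → T a) → a ≡ b
T-ext {false} {false} _   _   = refl
T-ext {false} {true}  _   b⇒a = ⊥-elim (b⇒a _)
T-ext {true}  {false} a⇒b _   = ⊥-elim (a⇒b _)
T-ext {true}  {true}  _   _   = refl

¬T-not : ∀ {b} → T (not b) → ¬ T b
¬T-not {false} _ ()

T-all : ∀ {n} (h : Fin n → Bool) → T (all h (allFin n)) ⇔ (∀ u → T (h u))
T-all h = mk⇔ (λ t u → All.lookup (all⁺ h _ t) (∈-allFin u))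
              (λ t → all⁻ h {allFin _} (All.tabulate (λ {u} _ → t u)))

T-any : ∀ {n} (h : Fin n → Bool) → T (any h (allFin n)) ⇔ ∃ (T ∘ h)
T-any h = mk⇔ (satisfied ∘ any⁻ h (allFin _)) (λ (u , t) → any⁺ {xs = allFin _} h (lose {P = T ∘ h} (∈-allFin u) t))

all-cong : ∀ {A : Set} {p q : A → Bool} (xs : List A) → (∀ u → p u ≡ q u) → all p xs ≡ all q xs
all-cong xs p≗q = cong and (map-cong p≗q xs)

any-cong : ∀ {A : Set} {p q : A → Bool} (xs : List A) → (∀ u → p u ≡ q u) → any p xs ≡ any q xs
any-cong xs p≗q = cong or (map-cong p≗q xs)

module Pullback {m n : ℕ} (G : Graph n) (f : Fin m → Fin n)
                (s : Fin n → Fin m) (f∘s : ∀ u → f (s u) ≡ u) where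

  G* : Graph m
  G* = record { adj      = λ a b → adj G (f a) (f b)
              ; adj-refl = λ a → adj-refl G (f a)
              ; adj-sym  = λ a b → adj-sym G (f a) (f b) }

  via-section : ∀ (P : Fin n → Set) u → P u → P (f (s u))
  via-section P u = subst P (sym (f∘s u))

  -- quantifying over G* through f is quantifying over G, since f is onto
  all-pull : (h : Fin n → Bool) → all (h ∘ f) (allFin m) ≡ all h (allFin n)
  all-pull h = T-ext
    (λ t → from (T-all h) λ u → subst (T ∘ h) (f∘s u) (to (T-all (h ∘ f)) t (s u)))
    (λ t → from (T-all (h ∘ f)) λ a → to (T-all h) t (f a))

  any-pull : (h : Fin n → Bool) → any (h ∘ f) (allFin m) ≡ any h (allFin n)
  any-pull h = T-ext
    (λ t → let (a , ha) = to (T-any (h ∘ f)) t in from (T-any h) (f a , ha))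
    (λ t → let (u , hu) = to (T-any h) t in
           from (T-any (h ∘ f)) (s u , via-section (T ∘ h) u hu))

  module _ (S* : VSet m) (S : VSet n) (S*≗S∘f : ∀ a → S* a ≡ S (f a)) where

    strictlyCorners-pull : ∀ w a → strictlyCorners G* S* w a ≡ strictlyCorners G S (f w) (f a)
    strictlyCorners-pull w a =
      cong₂ _∧_ (S*≗S∘f w) (cong₂ _∧_ (S*≗S∘f a) (cong₂ _∧_ contained strictly))
      where
        contained : all (λ u → not (S* u ∧ adj G (f a) (f u)) ∨ adj G (f w) (f u)) (allFin m)
                  ≡ all (λ u → not (S u ∧ adj G (f a) u) ∨ adj G (f w) u) (allFin n)
        contained = trans (all-cong (allFin m) λ u →
                             cong (λ b → not (b ∧ adj G (f a) (f u)) ∨ adj G (f w) (f u)) (S*≗S∘f u))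
                          (all-pull _)
        strictly : any (λ u → S* u ∧ adj G (f w) (f u) ∧ not (adj G (f a) (f u))) (allFin m)
                 ≡ any (λ u → S u ∧ adj G (f w) u ∧ not (adj G (f a) u)) (allFin n)
        strictly = trans (any-cong (allFin m) λ u →
                            cong (λ b → b ∧ adj G (f w) (f u) ∧ not (adj G (f a) (f u))) (S*≗S∘f u))
                         (any-pull _)

    deleteCorners-pull : ∀ a → deleteCorners G* S* a ≡ deleteCorners G S (f a)
    deleteCorners-pull a = cong₂ (λ b c → b ∧ not c) (S*≗S∘f a) isStrictCorner-pull
      where
        isStrictCorner-pull : isStrictCorner G* S* a ≡ isStrictCorner G S (f a)
        isStrictCorner-pull =
          cong₂ _∧_ (S*≗S∘f a)
                (trans (any-cong (allFin m) λ w → strictlyCorners-pull w a) (any-pull _))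

    isClique-pull : isClique G* S* ≡ isClique G S
    isClique-pull = trans (all-cong (allFin m) λ u → trans
                            (all-cong (allFin m) λ w →
                               cong₂ (λ b c → not (b ∧ c) ∨ adj G (f u) (f w)) (S*≗S∘f u) (S*≗S∘f w))
                            (all-pull _))
                          (all-pull _)

  stage-pull : ∀ k a → stage G* k a ≡ stage G k (f a)
  stage-pull zero          a = refl
  stage-pull (suc zero)    a = refl
  stage-pull (suc (suc k)) a = deleteCorners-pull (stage G* (suc k)) (stage G (suc k)) (stage-pull (suc k)) a

  hasRank-pull : ∀ α k a → hasRank G* α k a ≡ hasRank G α k (f a)
  hasRank-pull α k a =
    cong₂ (λ p q → p ∧ ((k ≡ᵇ α) ∨ not q)) (stage-pull k a) (stage-pull (suc k) a)

  hasCornerRank-pull : ∀ {α} → HasCornerRank G α → HasCornerRank G* α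
  hasCornerRank-pull {α} (1≤α , clique , noEarlierClique) =
    1≤α , subst T (sym (clique-at α)) clique ,
    λ k 1≤k k<α → noEarlierClique k 1≤k k<α ∘ subst T (clique-at k)
    where
      clique-at : ∀ k → isClique G* (stage G* k) ≡ isClique G (stage G k)
      clique-at k = isClique-pull (stage G* k) (stage G k) (stage-pull k)

  type1-pull : ∀ {α} → Type1 G α → Type1 G* α
  type1-pull {α} (w , w-rank , w-dominates) =
    s w , subst T (sym (hasRank-pull α α (s w))) (via-section (λ v → T (hasRank G α α v)) w w-rank) ,
    λ a a-in → via-section (λ v → T (adj G v (f a))) w
                 (w-dominates (f a) (subst T (stage-pull (α ∸ 1) a) a-in))

  type1-push : ∀ {α} → Type1 G* α → Type1 G α
  type1-push {α} (a , a-rank , a-dominates) =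
    f a , subst T (hasRank-pull α α a) a-rank ,
    λ u u-in → subst (λ v → T (adj G (f a) v)) (f∘s u)
                 (a-dominates (s u) (subst T (sym (stage-pull (α ∸ 1) (s u)))
                                      (via-section (λ v → T (stage G (α ∸ 1) v)) u u-in)))

  hasType-pull : ∀ {α} r → HasType G α r → HasType G* α r
  hasType-pull {α} Fin.zero           notType1 = notType1 ∘ type1-push {α}
  hasType-pull {α} (Fin.suc Fin.zero) type1    = type1-pull {α} type1

-- The stages decrease, so a vertex has at most one rank.
module Ranks {n : ℕ} (G : Graph n) where

  stage-step : ∀ k u → T (stage G (suc k) u) → T (stage G k u)
  stage-step zero    u _ = _
  stage-step (suc k) u t = proj₁ (to T-∧ t)

  stage-antitone : ∀ {j k} u → j ≤′ k → T (stage G k u) → T (stage G j u)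
  stage-antitone u ≤′-refl        = λ t → t
  stage-antitone {k = suc k} u (≤′-step j≤′k) = stage-antitone u j≤′k ∘ stage-step k u

  no-later-rank : ∀ {α k k'} u → T (hasRank G α k u) → T (hasRank G α k' u) → k < k' → k' ≤ α → ⊥
  no-later-rank {α} {k} {k'} u rank-k rank-k' k<k' k'≤α with to T-∨ (proj₂ (to T-∧ rank-k))
  ... | inj₁ k≡ᵇα = <-irrefl (≡ᵇ⇒≡ k α k≡ᵇα) (≤-trans k<k' k'≤α)
  ... | inj₂ u-deleted =
    ¬T-not u-deleted (stage-antitone u (≤⇒≤′ k<k') (proj₁ (to T-∧ rank-k')))

  rank-unique : ∀ {α k k'} u → T (hasRank G α k u) → T (hasRank G α k' u) → k ≤ α → k' ≤ α → k ≡ k'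
  rank-unique {k = k} {k'} u rank-k rank-k' k≤α k'≤α with <-cmp k k'
  ... | tri< k<k' _ _ = ⊥-elim (no-later-rank u rank-k rank-k' k<k' k'≤α)
  ... | tri≈ _ k≡k' _ = k≡k'
  ... | tri> _ _ k'<k = ⊥-elim (no-later-rank u rank-k' rank-k k'<k k≤α)

ind : Bool → ℕ
ind b = if b then 1 else 0

ind-true : ∀ {b} → T b → ind b ≡ 1
ind-true {true} _ = refl

ind-false : ∀ {b} → ¬ T b → ind b ≡ 0
ind-false {false} _ = refl
ind-false {true}  ¬t = ⊥-elim (¬t _)

count-witness : ∀ {A : Set} (p : A → Bool) (xs : List A) → 1 ≤ sum (map (ind ∘ p) xs) → ∃ (T ∘ p)
count-witness p []       ()
count-witness p (x ∷ xs) positive with p x in px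
... | true  = x , subst T (sym px) _
... | false = count-witness p xs positive

-- twin v identifies the new vertex 0 with v; its section is Fin.suc.
twin : ∀ {n} → Fin n → Fin (suc n) → Fin n
twin v Fin.zero    = v
twin v (Fin.suc u) = u

sum-twin : ∀ {n} (v : Fin n) (g : Fin n → ℕ) →
           sum (map (g ∘ twin v) (allFin (suc n))) ≡ g v + sum (map g (allFin n))
sum-twin v g = cong (λ l → g v + sum l) (trans (map-tabulate Fin.suc (g ∘ twin v))
                                               (sym (map-tabulate (λ u → u) g)))

module Twin {n : ℕ} (G : Graph n) (v : Fin n) where
  open Pullback G (twin v) Fin.suc (λ _ → refl) public

  rankCount-twin : ∀ α k → rankCount G* α k ≡ ind (hasRank G α k v) + rankCount G α k
  rankCount-twin α k =
    trans (cong sum (map-cong (λ a → cong ind (hasRank-pull α k a)) (allFin (suc n))))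
          (sum-twin v (ind ∘ hasRank G α k))

-- Induction on the length: first raise the head
-- to its target, then treat the tail with the head fixed.
upward-closed : ∀ {α} (P : Vector ℕ α → Set) →
                (∀ {x x'} → x ≗ x' → P x → P x') →
                (∀ {x} i → P x → P (updateAt x i suc)) →
                ∀ {x y} → P x → (∀ i → x i ≤ y i) → P y
upward-closed {zero}  P resp increment px _ = resp (λ ()) px
upward-closed {suc α} P resp increment {x} {y} px x≤y =
  resp (λ { Fin.zero → refl ; (Fin.suc j) → refl })
       (upward-closed (P ∘ (y Fin.zero ◂_)) resp-tail increment-tail head-raised (x≤y ∘ Fin.suc))
  where
    raise-head : ∀ d → P ((d + x Fin.zero) ◂ (x ∘ Fin.suc))
    raise-head zero    = resp (λ { Fin.zero → refl ; (Fin.suc j) → refl }) px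
    raise-head (suc d) = resp (λ { Fin.zero → refl ; (Fin.suc j) → refl })
                              (increment Fin.zero (raise-head d))

    head-raised : P (y Fin.zero ◂ (x ∘ Fin.suc))
    head-raised = subst (λ c → P (c ◂ (x ∘ Fin.suc))) (m∸n+n≡m (x≤y Fin.zero))
                        (raise-head (y Fin.zero ∸ x Fin.zero))

    resp-tail : ∀ {xs xs'} → xs ≗ xs' → P (y Fin.zero ◂ xs) → P (y Fin.zero ◂ xs')
    resp-tail xs≗xs' = resp (λ { Fin.zero → refl ; (Fin.suc j) → xs≗xs' j })

    increment-tail : ∀ {xs} i → P (y Fin.zero ◂ xs) → P (y Fin.zero ◂ updateAt xs i suc)
    increment-tail i = resp (λ { Fin.zero → refl ; (Fin.suc j) → refl }) ∘ increment (Fin.suc i)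

realizable-resp : ∀ {r α} {x x' : Fin α → ℕ} → x ≗ x' → Realizable r α x → Realizable r α x'
realizable-resp x≗x' (positive , n , 1≤n , G , rank , type , count) =
  (λ j → subst (1 ≤_) (x≗x' j) (positive j)) , n , 1≤n , G , rank , type ,
  (λ j → trans (count j) (x≗x' j))

-- Twinning a vertex of rank i+1 realizes x + e_i.
add-twin : ∀ {r α} {x : Fin α → ℕ} (i : Fin α) → Realizable r α x → Realizable r α (updateAt x i suc)
add-twin {r} {α} {x} i (positive , n , _ , G , rank , type , count) =
  positive' , suc n , s≤s z≤n , G* , hasCornerRank-pull rank , hasType-pull r type , count'
  where
    witness : ∃ λ v → T (hasRank G α (suc (toℕ i)) v)
    witness = count-witness (hasRank G α (suc (toℕ i))) (allFin n)
                            (subst (1 ≤_) (sym (count i)) (positive i))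
    v = proj₁ witness
    open Twin G v
    open Ranks G

    positive' : ∀ j → 1 ≤ updateAt x i suc j
    positive' j with j ≟ i
    ... | yes refl = subst (1 ≤_) (sym (updateAt-updates i x)) (s≤s z≤n)
    ... | no j≢i   = subst (1 ≤_) (sym (updateAt-minimal j i x j≢i)) (positive j)

    count' : ∀ j → rankCount G* α (suc (toℕ j)) ≡ updateAt x i suc j
    count' j with j ≟ i
    ... | yes refl = begin
      rankCount G* α (suc (toℕ i))                               ≡⟨ rankCount-twin α (suc (toℕ i)) ⟩
      ind (hasRank G α (suc (toℕ i)) v) + rankCount G α (suc (toℕ i)) ≡⟨ cong₂ _+_ (ind-true (proj₂ witness)) (count i) ⟩
      suc (x i)                                                  ≡⟨ updateAt-updates i x ⟨
      updateAt x i suc i                                         ∎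
    ... | no j≢i = begin
      rankCount G* α (suc (toℕ j))                               ≡⟨ rankCount-twin α (suc (toℕ j)) ⟩
      ind (hasRank G α (suc (toℕ j)) v) + rankCount G α (suc (toℕ j)) ≡⟨ cong₂ _+_ (ind-false v-not-rank-j) (count j) ⟩
      x j                                                        ≡⟨ updateAt-minimal j i x j≢i ⟨
      updateAt x i suc j                                         ∎
      where
        v-not-rank-j : ¬ T (hasRank G α (suc (toℕ j)) v)
        v-not-rank-j rank-j = j≢i (toℕ-injective (suc-injective
          (rank-unique v rank-j (proj₂ witness) (toℕ<n j) (toℕ<n i))))

lemma3p6 : (r : Fin 2) (α : ℕ) (x y : Fin α → ℕ) →
    Realizable r α x → (∀ i → x i ≤ y i) → Realizable r α y
lemma3p6 r α x y realizable x≤y =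
  upward-closed (Realizable r α) realizable-resp add-twin realizable x≤y
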